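{- Let $T$ be a tournament with $\Delta(T) \geq 3$, and let $\{M,N,L\}$ be a co-modular decomposition of $T$ with three elements such that $M \in {\rm mc}(T)$. Suppose there are $x \in M$ and $y \in N$ such that the arcs between $x$ and $L$ all have the same orientation, the arcs between $y$ and $L$ all have the same orientation, and these orientations differ: i.e., either $(x,\ell)\in A(T)$ and $(\ell,y)\in A(T)$ for all $\ell\in L$, or $(\ell,x)\in A(T)$ and $(y,\ell)\in A(T)$ for all $\ell \in L$. Let $T' = {\rm Inv}(T,\{x,y\})$ and let $I \in {\rm mc}(T')$. If $I \cap M \neq \emptyset$ and $I \cap N = \emptyset$, then $x \notin I$ and $I \in O_T(M)$.
   Context: A tournament $T$ is a finite vertex set $V(T)$ with an arc set $A(T)$ such that for all distinct $x,y$, exactly one of $(x,y),(y,x)$ lies in $A(T)$. ${\rm Inv}(T,\{x,y\})$ is the tournament obtained by reversing the arc between $x$ and $y$. A module of $T$ is a subset $M$ such that for all $x,y \in M$ and $v \notin M$, $(v,x)\in A(T)$ iff $(v,y)\in A(T)$; trivial modules are $\emptyset$, singletons and $V(T)$. With $\overline{X} = V(T)\setminus X$, a co-module is a set $M$ such that $M$ or $\overline{M}$ is a nontrivial module; a co-modular decomposition is a set of pairwise disjoint co-modules; $\Delta(T)$ is the largest size of a co-modular decomposition. A minimal co-module is one containing no other co-module; ${\rm mc}(T)$ is the set of these. Two sets overlap if their intersection and both differences are nonempty. For $M\in{\rm mc}(T)$, $O_T(M)$ is the set of $N\in{\rm mc}(T)$ overlapping $M$. -}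

module Defs where

open import Data.Nat using (ℕ; _≤_)
open import Data.Bool using (Bool; true; false; not; _∧_; _∨_; if_then_else_)
open import Data.Fin using (Fin; _≟_)
open import Data.Fin.Subset public
  using (Subset; _∈_; _∉_; _⊆_; _∩_; _─_; ∁; ⁅_⁆; ⊥; ⊤; Nonempty; Empty)
open import Data.List using (List; length)
open import Data.List.Relation.Unary.All using (All)
open import Data.List.Relation.Unary.AllPairs using (AllPairs)
open import Data.Product using (_×_; ∃)
open import Data.Sum using (_⊎_)
open import Relation.Nullary using (¬_)
open import Relation.Nullary.Decidable using (⌊_⌋)
open import Relation.Binary.PropositionalEquality using (_≡_; _≢_)

-- A binary "arc" relation on the vertex set Fin n: arc u v ≡ true iff (u,v) ∈ A(T).
Arc : ℕ → Set
Arc n = Fin n → Fin n → Bool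

record IsTournament {n : ℕ} (A : Arc n) : Set where
  field
    irrefl : ∀ x → A x x ≡ false
    tour   : ∀ x y → x ≢ y → A y x ≡ not (A x y)

Inv : ∀ {n} → Arc n → Fin n → Fin n → Arc n
Inv A x y u v =
  if (⌊ u ≟ x ⌋ ∧ ⌊ v ≟ y ⌋) ∨ (⌊ u ≟ y ⌋ ∧ ⌊ v ≟ x ⌋) then not (A u v) else A u v

IsModule : ∀ {n} → Arc n → Subset n → Set
IsModule A M = ∀ x y v → x ∈ M → y ∈ M → v ∉ M → A v x ≡ A v y

IsTrivial : ∀ {n} → Subset n → Set
IsTrivial M = M ≡ ⊥ ⊎ (∃ λ x → M ≡ ⁅ x ⁆) ⊎ M ≡ ⊤

IsNontrivialModule : ∀ {n} → Arc n → Subset n → Set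
IsNontrivialModule A M = IsModule A M × ¬ IsTrivial M

IsCoModule : ∀ {n} → Arc n → Subset n → Set
IsCoModule A M = IsNontrivialModule A M ⊎ IsNontrivialModule A (∁ M)

Disjoint : ∀ {n} → Subset n → Subset n → Set
Disjoint P Q = Empty (P ∩ Q)

-- Co-modular decomposition: pairwise disjoint co-modules (listed without repetition;
-- pairwise disjointness of nonempty sets forces the entries to be distinct).
IsCoModularDecomposition : ∀ {n} → Arc n → List (Subset n) → Set
IsCoModularDecomposition A Ds = All (IsCoModule A) Ds × AllPairs Disjoint Ds

ΔAtLeast : ∀ {n} → Arc n → ℕ → Set
ΔAtLeast A k = ∃ λ Ds → IsCoModularDecomposition A Ds × k ≤ length Ds

IsMinimalCoModule : ∀ {n} → Arc n → Subset n → Set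
IsMinimalCoModule A M = IsCoModule A M × (∀ K → IsCoModule A K → K ⊆ M → K ≡ M)

Overlap : ∀ {n} → Subset n → Subset n → Set
Overlap P Q = Nonempty (P ∩ Q) × Nonempty (P ─ Q) × Nonempty (Q ─ P)

InO : ∀ {n} → Arc n → Subset n → Subset n → Set
InO A M N = IsMinimalCoModule A N × Overlap M N

-- Inverting {x,y} changes only the arc between x and y, so the co-modules of T′ avoiding x and y
-- are those of T. Since y ∈ N misses I, everything reduces to x ∉ I, after which minimality of M
-- (with x ∈ M ∖ I) gives the overlap. If x ∈ I, then in T′ either I is a module, so y sees x and
-- some other i ∈ I alike, or ∁ I is one, so x sees y and some w ∉ I alike. The flipped arc makes
-- that pair look different in T, whereas in T the co-module N forces them alike: via a vertex of
-- N ∖ {y} when N is a module, and, when ∁ N and ∁ I are the modules, via a vertex of L ∖ I, which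
-- exists by minimality of I and is seen by x and y in opposite ways.
module Submission where

open import Defs
open import Data.Nat using (ℕ)
open import Data.Bool using (true; not)
open import Data.Bool.Properties using (∧-zeroʳ; not-¬)
open import Data.Fin using (Fin; _≟_)
open import Data.Fin.Properties using (any?)
open import Data.Fin.Subset.Properties
  using (_∈?_; x∈p∩q⁺; x∈p∩q⁻; x∈p∧x∉q⇒x∈p─q; ⊆-antisym; x∈⁅y⁆⇒x≡y;
         x∉⁅y⁆⇒x≢y; x∈p⇒x∉∁p; x∉p⇒x∈∁p; x∈∁p⇒x∉p; x∉∁p⇒x∈p)
open import Data.Product using (_×_; _,_; proj₁; proj₂; ∃; swap)
open import Data.Sum using (_⊎_; inj₁; inj₂)
open import Function using (_∘_)
open import Relation.Nullary using (¬_; yes; no; contradiction)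
open import Relation.Nullary.Decidable using (_×-dec_; ¬?; decidable-stable; isYes)
open import Relation.Binary.PropositionalEquality
  using (_≡_; _≢_; refl; sym; ≢-sym; trans; cong; subst; module ≡-Reasoning)

module _ {n : ℕ} where

  ∈⇒≢ : ∀ {S : Subset n} {a b} → a ∈ S → b ∉ S → a ≢ b
  ∈⇒≢ {S} a∈S b∉S refl = b∉S a∈S

  Disjoint⇒∉ : ∀ {P Q : Subset n} {a} → Disjoint P Q → a ∈ P → a ∉ Q
  Disjoint⇒∉ P∩Q=∅ a∈P a∈Q = P∩Q=∅ (_ , x∈p∩q⁺ (a∈P , a∈Q))

  Disjoint⇒∉ʳ : ∀ {P Q : Subset n} {a} → Disjoint P Q → a ∈ Q → a ∉ P
  Disjoint⇒∉ʳ P∩Q=∅ a∈Q a∈P = P∩Q=∅ (_ , x∈p∩q⁺ (a∈P , a∈Q))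

  Nonempty-─⁺ : ∀ {P Q : Subset n} {a} → a ∈ P → a ∉ Q → Nonempty (P ─ Q)
  Nonempty-─⁺ a∈P a∉Q = _ , x∈p∧x∉q⇒x∈p─q a∈P a∉Q

  ⊆⊎∃∉ : (P Q : Subset n) → P ⊆ Q ⊎ ∃ λ a → a ∈ P × a ∉ Q
  ⊆⊎∃∉ P Q with any? (λ a → a ∈? P ×-dec ¬? (a ∈? Q))
  ... | yes found = inj₂ found
  ... | no ¬found = inj₁ λ {a} a∈P →
    decidable-stable (a ∈? Q) (λ a∉Q → ¬found (a , a∈P , a∉Q))

  nontrivial⇒∃≢ : ∀ {S : Subset n} {a} → ¬ IsTrivial S → a ∈ S → ∃ λ b → b ∈ S × b ≢ a
  nontrivial⇒∃≢ {S} {a} nt a∈S with ⊆⊎∃∉ S ⁅ a ⁆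
  ... | inj₂ (b , b∈S , b∉a) = b , b∈S , x∉⁅y⁆⇒x≢y b∉a
  ... | inj₁ S⊆a = contradiction (inj₂ (inj₁ (a , ⊆-antisym S⊆a a⊆S))) nt
    where
    a⊆S : ⁅ a ⁆ ⊆ S
    a⊆S b∈a = subst (_∈ S) (sym (x∈⁅y⁆⇒x≡y a b∈a)) a∈S

  AgreeAcross : Arc n → Arc n → Subset n → Set
  AgreeAcross A₁ A₂ S = ∀ u v → u ∈ S → v ∉ S → A₁ u v ≡ A₂ u v × A₁ v u ≡ A₂ v u

  module _ {A₁ A₂ : Arc n} where

    AgreeAcross-sym : ∀ {S} → AgreeAcross A₁ A₂ S → AgreeAcross A₂ A₁ S
    AgreeAcross-sym agree u v u∈S v∉S with agree u v u∈S v∉S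
    ... | uv , vu = sym uv , sym vu

    AgreeAcross-∁ : ∀ {S} → AgreeAcross A₁ A₂ S → AgreeAcross A₁ A₂ (∁ S)
    AgreeAcross-∁ agree u v u∈∁S v∉∁S = swap (agree v u (x∉∁p⇒x∈p v∉∁S) (x∈∁p⇒x∉p u∈∁S))

    IsModule-agree : ∀ {S} → AgreeAcross A₁ A₂ S → IsModule A₁ S → IsModule A₂ S
    IsModule-agree agree mod a b v a∈S b∈S v∉S = begin
      A₂ v a ≡⟨ sym (proj₂ (agree a v a∈S v∉S)) ⟩
      A₁ v a ≡⟨ mod a b v a∈S b∈S v∉S ⟩
      A₁ v b ≡⟨ proj₂ (agree b v b∈S v∉S) ⟩
      A₂ v b ∎
      where open ≡-Reasoning

    IsCoModule-agree : ∀ {S} → AgreeAcross A₁ A₂ S → IsCoModule A₁ S → IsCoModule A₂ S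
    IsCoModule-agree agree (inj₁ (mod , nt)) = inj₁ (IsModule-agree agree mod , nt)
    IsCoModule-agree agree (inj₂ (mod , nt)) = inj₂ (IsModule-agree (AgreeAcross-∁ agree) mod , nt)

  module _ (A : Arc n) {x y : Fin n} where

    Inv-awayˡ : ∀ {w v} → w ≢ x → w ≢ y → Inv A x y w v ≡ A w v
    Inv-awayˡ {w} w≢x w≢y with w ≟ x | w ≟ y
    ... | yes w≡x | _       = contradiction w≡x w≢x
    ... | no _    | yes w≡y = contradiction w≡y w≢y
    ... | no _    | no _    = refl

    Inv-awayʳ : ∀ {u w} → w ≢ x → w ≢ y → Inv A x y u w ≡ A u w
    Inv-awayʳ {u} {w} w≢x w≢y with w ≟ y | w ≟ x
    ... | yes w≡y | _       = contradiction w≡y w≢y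
    ... | no _    | yes w≡x = contradiction w≡x w≢x
    ... | no _    | no _ rewrite ∧-zeroʳ (isYes (u ≟ x)) | ∧-zeroʳ (isYes (u ≟ y)) = refl

    Inv-xy : Inv A x y x y ≡ not (A x y)
    Inv-xy with x ≟ x | y ≟ y
    ... | yes _  | yes _  = refl
    ... | no x≢x | _      = contradiction refl x≢x
    ... | yes _  | no y≢y = contradiction refl y≢y

    Inv-yx : x ≢ y → Inv A x y y x ≡ not (A y x)
    Inv-yx x≢y with y ≟ x | y ≟ y | x ≟ x
    ... | yes y≡x | _      | _      = contradiction (sym y≡x) x≢y
    ... | no _    | yes _  | yes _  = refl
    ... | no _    | no y≢y | _      = contradiction refl y≢y
    ... | no _    | yes _  | no x≢x = contradiction refl x≢x

    Inv-agreeAcross : ∀ {S} → x ∉ S → y ∉ S → AgreeAcross A (Inv A x y) S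
    Inv-agreeAcross x∉S y∉S u v u∈S v∉S =
      sym (Inv-awayˡ (∈⇒≢ u∈S x∉S) (∈⇒≢ u∈S y∉S)) , sym (Inv-awayʳ (∈⇒≢ u∈S x∉S) (∈⇒≢ u∈S y∉S))

    IsMinimalCoModule-Inv⁻ : ∀ {I} → x ∉ I → y ∉ I
                           → IsMinimalCoModule (Inv A x y) I → IsMinimalCoModule A I
    IsMinimalCoModule-Inv⁻ x∉I y∉I (coI , minI) =
      IsCoModule-agree (AgreeAcross-sym (Inv-agreeAcross x∉I y∉I)) coI ,
      λ K coK K⊆I → minI K (IsCoModule-agree (Inv-agreeAcross (x∉I ∘ K⊆I) (y∉I ∘ K⊆I)) coK) K⊆I

    Inv-x-splits : ∀ {w} → w ≢ x → w ≢ y → A x w ≡ A x y → Inv A x y x w ≢ Inv A x y x y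
    Inv-x-splits {w} w≢x w≢y Axw≡Axy Bxw≡Bxy = not-¬ refl (begin
      A x y             ≡⟨ sym Axw≡Axy ⟩
      A x w             ≡⟨ sym (Inv-awayʳ w≢x w≢y) ⟩
      Inv A x y x w     ≡⟨ Bxw≡Bxy ⟩
      Inv A x y x y     ≡⟨ Inv-xy ⟩
      not (A x y)       ∎)
      where open ≡-Reasoning

    Inv-y-splits : ∀ {w} → x ≢ y → w ≢ x → w ≢ y → A y w ≡ A y x → Inv A x y y w ≢ Inv A x y y x
    Inv-y-splits {w} x≢y w≢x w≢y Ayw≡Ayx Byw≡Byx = not-¬ refl (begin
      A y x             ≡⟨ sym Ayw≡Ayx ⟩
      A y w             ≡⟨ sym (Inv-awayʳ w≢x w≢y) ⟩
      Inv A x y y w     ≡⟨ Byw≡Byx ⟩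
      Inv A x y y x     ≡⟨ Inv-yx x≢y ⟩
      not (A y x)       ∎)
      where open ≡-Reasoning

  minimal-overlaps : ∀ {A : Arc n} {M I a} → IsMinimalCoModule A M → IsCoModule A I
                   → Nonempty (I ∩ M) → a ∈ M → a ∉ I → Overlap M I
  minimal-overlaps {_} {M} {I} {a} (_ , minM) coI (b , b∈I∩M) a∈M a∉I =
    (b , x∈p∩q⁺ (swap (x∈p∩q⁻ I M b∈I∩M))) , Nonempty-─⁺ a∈M a∉I , I─M
    where
    I─M : Nonempty (I ─ M)
    I─M with ⊆⊎∃∉ I M
    ... | inj₁ I⊆M = contradiction (subst (a ∈_) (sym (minM I coI I⊆M)) a∈M) a∉I
    ... | inj₂ (c , c∈I , c∉M) = Nonempty-─⁺ c∈I c∉M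

  module _ {A : Arc n} (T : IsTournament A) where

    converse-≡ : ∀ {a b c d} → a ≢ b → c ≢ d → A a b ≡ A c d → A b a ≡ A d c
    converse-≡ {a} {b} {c} {d} a≢b c≢d Aab≡Acd = begin
      A b a        ≡⟨ IsTournament.tour T a b a≢b ⟩
      not (A a b)  ≡⟨ cong not Aab≡Acd ⟩
      not (A c d)  ≡⟨ sym (IsTournament.tour T c d c≢d) ⟩
      A d c        ∎
      where open ≡-Reasoning

    opposite-orientations : ∀ {x y L} → x ∉ L → y ∉ L
      → ((∀ l → l ∈ L → A x l ≡ true × A l y ≡ true) ⊎ (∀ l → l ∈ L → A l x ≡ true × A y l ≡ true))
      → ∀ l → l ∈ L → A x l ≡ A l y
    opposite-orientations x∉L y∉L (inj₁ out-in) l l∈L =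
      trans (proj₁ (out-in l l∈L)) (sym (proj₂ (out-in l l∈L)))
    opposite-orientations x∉L y∉L (inj₂ in-out) l l∈L =
      converse-≡ (∈⇒≢ l∈L x∉L) (≢-sym (∈⇒≢ l∈L y∉L)) (trans (proj₁ (in-out l l∈L)) (sym (proj₂ (in-out l l∈L))))

    module _ {x y : Fin n} (x≢y : x ≢ y) {N L I : Subset n}
      (y∈N : y ∈ N) (x∉N : x ∉ N)
      (coL : IsCoModule A L) (x∉L : x ∉ L) (y∉L : y ∉ L) (N∩L=∅ : Disjoint N L)
      (orient : ∀ l → l ∈ L → A x l ≡ A l y)
      (minI : IsMinimalCoModule (Inv A x y) I) (I∩N=∅ : Empty (I ∩ N)) where

      private
        ∈N⇒∉I : ∀ {a} → a ∈ N → a ∉ I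
        ∈N⇒∉I = Disjoint⇒∉ʳ I∩N=∅

        y∉I : y ∉ I
        y∉I = ∈N⇒∉I y∈N

      x-unsplit-outside : IsCoModule A N → x ∈ I → ∃ λ w → w ∉ I × w ≢ x × w ≢ y × A x w ≡ A x y
      x-unsplit-outside (inj₁ (modN , ntN)) x∈I with nontrivial⇒∃≢ ntN y∈N
      ... | w , w∈N , w≢y = w , ∈N⇒∉I w∈N , ∈⇒≢ w∈N x∉N , w≢y , modN w y x w∈N y∈N x∉N
      x-unsplit-outside (inj₂ (mod∁N , _)) x∈I with ⊆⊎∃∉ L I
      ... | inj₁ L⊆I = contradiction (subst (x ∈_) (sym L≡I) x∈I) x∉L
        where
        L≡I : L ≡ I
        L≡I = proj₂ minI L (IsCoModule-agree (Inv-agreeAcross A x∉L y∉L) coL) L⊆I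
      ... | inj₂ (l , l∈L , l∉I) = l , l∉I , l≢x , ∈⇒≢ l∈L y∉L , (begin
        A x l ≡⟨ orient l l∈L ⟩
        A l y ≡⟨ converse-≡ (≢-sym (∈⇒≢ l∈L y∉L)) (≢-sym x≢y) (sym Ayx≡Ayl) ⟩
        A x y ∎)
        where
        open ≡-Reasoning
        l≢x : l ≢ x
        l≢x = ∈⇒≢ l∈L x∉L
        Ayx≡Ayl : A y x ≡ A y l
        Ayx≡Ayl = mod∁N x l y (x∉p⇒x∈∁p x∉N) (x∉p⇒x∈∁p (Disjoint⇒∉ʳ N∩L=∅ l∈L)) (x∈p⇒x∉∁p y∈N)

      y-unsplit-inside : IsCoModule A N → x ∈ I → IsModule (Inv A x y) I
                       → ∀ {i} → i ∈ I → i ≢ x → A y i ≡ A y x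
      y-unsplit-inside (inj₂ (mod∁N , _)) x∈I modI {i} i∈I i≢x =
        sym (mod∁N x i y (x∉p⇒x∈∁p x∉N) (x∉p⇒x∈∁p (Disjoint⇒∉ I∩N=∅ i∈I)) (x∈p⇒x∉∁p y∈N))
      y-unsplit-inside (inj₁ (modN , ntN)) x∈I modI {i} i∈I i≢x with nontrivial⇒∃≢ ntN y∈N
      ... | w , w∈N , w≢y = sym (converse-≡ x≢y (∈⇒≢ i∈I y∉I) Axy≡Aiy)
        where
        w≢x : w ≢ x
        w≢x = ∈⇒≢ w∈N x∉N
        Awx≡Awi : A w x ≡ A w i
        Awx≡Awi = trans (sym (Inv-awayˡ A w≢x w≢y))
                    (trans (modI x i w x∈I i∈I (∈N⇒∉I w∈N)) (Inv-awayˡ A w≢x w≢y))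
        open ≡-Reasoning
        Axy≡Aiy : A x y ≡ A i y
        Axy≡Aiy = begin
          A x y ≡⟨ sym (modN w y x w∈N y∈N x∉N) ⟩
          A x w ≡⟨ converse-≡ w≢x (∈⇒≢ w∈N (Disjoint⇒∉ I∩N=∅ i∈I)) Awx≡Awi ⟩
          A i w ≡⟨ modN w y i w∈N y∈N (Disjoint⇒∉ I∩N=∅ i∈I) ⟩
          A i y ∎

      x∉mc : IsCoModule A N → x ∉ I
      x∉mc coN x∈I with proj₁ minI
      ... | inj₁ (modI , ntI) with nontrivial⇒∃≢ ntI x∈I
      ...   | i , i∈I , i≢x = Inv-y-splits A x≢y i≢x (∈⇒≢ i∈I y∉I)
                                (y-unsplit-inside coN x∈I modI i∈I i≢x) (sym (modI x i y x∈I i∈I y∉I))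
      x∉mc coN x∈I | inj₂ (mod∁I , _) with x-unsplit-outside coN x∈I
      ... | w , w∉I , w≢x , w≢y , Axw≡Axy = Inv-x-splits A w≢x w≢y Axw≡Axy
              (sym (mod∁I y w x (x∉p⇒x∈∁p y∉I) (x∉p⇒x∈∁p w∉I) (x∈p⇒x∉∁p x∈I)))

lemma9 : ∀ {n : ℕ} (A : Arc n) → IsTournament A → ΔAtLeast A 3
    → (M N L : Subset n)
    → IsCoModule A M → IsCoModule A N → IsCoModule A L
    → Disjoint M N → Disjoint M L → Disjoint N L
    → IsMinimalCoModule A M
    → (x y : Fin n) → x ∈ M → y ∈ N
    → ((∀ l → l ∈ L → A x l ≡ true × A l y ≡ true)
    ⊎ (∀ l → l ∈ L → A l x ≡ true × A y l ≡ true))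
    → (I : Subset n) → IsMinimalCoModule (Inv A x y) I
    → Nonempty (I ∩ M) → Empty (I ∩ N)
    → x ∉ I × InO A M I
lemma9 A T _ M N L _ coN coL M∩N=∅ M∩L=∅ N∩L=∅ minM x y x∈M y∈N orientations I minI I∩M≠∅ I∩N=∅ =
  x∉I , minI′ , minimal-overlaps minM (proj₁ minI′) I∩M≠∅ x∈M x∉I
  where
  x≢y : x ≢ y
  x≢y = ∈⇒≢ x∈M (Disjoint⇒∉ʳ M∩N=∅ y∈N)
  x∉L : x ∉ L
  x∉L = Disjoint⇒∉ M∩L=∅ x∈M
  y∉L : y ∉ L
  y∉L = Disjoint⇒∉ N∩L=∅ y∈N
  x∉I : x ∉ I
  x∉I = x∉mc T x≢y y∈N (Disjoint⇒∉ M∩N=∅ x∈M) coL x∉L y∉L N∩L=∅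
          (opposite-orientations T x∉L y∉L orientations) minI I∩N=∅ coN
  minI′ : IsMinimalCoModule A I
  minI′ = IsMinimalCoModule-Inv⁻ A x∉I (Disjoint⇒∉ʳ I∩N=∅ y∈N) minI
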